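{- For all integers $n \ge 2$, the number $\hat{d}_n$ of c-derangements of the facets of the $n$-dimensional hypercube satisfies \[ \hat{d}_n = (2n-1)\hat{d}_{n-1} + (2n-2)\hat{d}_{n-2}. \]
   Context: Let $Q_n$ be the regular $n$-dimensional hypercube, e.g. $[-1,1]^n\subset\mathbb{R}^n$, whose $2n$ facets are labelled $1,1^*,\dots,n,n^*$ with $\{i,i^*\}$ the pairs of opposite facets. A c-derangement is an isometry of $Q_n$ fixing no facet; equivalently, a permutation of the $2n$ symbols $1,1^*,\dots,n,n^*$ that maps each pair $\{i,i^*\}$ onto some pair $\{j,j^*\}$ and has no fixed point. $\hat{d}_n$ is the number of c-derangements of $Q_n$, with the conventions $\hat{d}_0 = 1$ (and $\hat{d}_1 = 1$). -}

module Defs where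

open import Data.Nat using (ℕ; zero; suc)
open import Data.Bool using (Bool; true; false; _∧_; not)
open import Data.Fin using (Fin)
open import Data.Fin.Properties using () renaming (_≟_ to _≟ᶠ_)
open import Data.Bool.Properties using () renaming (_≟_ to _≟ᵇ_)
open import Data.Product using (_×_; _,_; proj₁; proj₂)
open import Data.Product.Properties using (≡-dec)
open import Data.List using (List; []; _∷_; map; concatMap; cartesianProduct; filter; length)
open import Data.Bool.ListAction using (all; any)
open import Data.List.Base using (allFin)
open import Data.Vec using (Vec; []; _∷_; lookup)
open import Relation.Nullary using (does)
open import Relation.Binary.PropositionalEquality using (_≡_)

-- Facets of Q_n: (i , false) is facet i, (i , true) is facet i*.
Facet : ℕ → Set
Facet n = Fin n × Bool

allFacets : (n : ℕ) → List (Facet n)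
allFacets n = cartesianProduct (allFin n) (true ∷ false ∷ [])

_≟F_ : ∀ {n} (x y : Facet n) → Relation.Nullary.Dec (x ≡ y)
_≟F_ = ≡-dec _≟ᶠ_ _≟ᵇ_

-- A map Facet n → Facet n, encoded by the table whose i-th entry is
-- (image of facet i , image of facet i*).  Tables are in bijection with
-- all functions Facet n → Facet n.
Table : ℕ → Set
Table n = Vec (Facet n × Facet n) n

apply : ∀ {n} → Table n → Facet n → Facet n
apply T (i , false) = proj₁ (lookup T i)
apply T (i , true)  = proj₂ (lookup T i)

allVecs : ∀ {A : Set} → List A → (m : ℕ) → List (Vec A m)
allVecs xs zero    = [] ∷ []
allVecs xs (suc m) = concatMap (λ x → map (x ∷_) (allVecs xs m)) xs

allTables : (n : ℕ) → List (Table n)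
allTables n = allVecs (cartesianProduct (allFacets n) (allFacets n)) n

isPerm : ∀ {n} → Table n → Bool
isPerm {n} T =
  all (λ x → all (λ y → not (does (apply T x ≟F apply T y)) Data.Bool.∨ does (x ≟F y)) (allFacets n)) (allFacets n)
  ∧ all (λ y → any (λ x → does (apply T x ≟F y)) (allFacets n)) (allFacets n)

-- f maps each pair {i , i*} onto some pair {j , j*}
-- (given injectivity: the images of i and i* lie in the same pair)
preservesPairs : ∀ {n} → Table n → Bool
preservesPairs {n} T =
  all (λ i → does (proj₁ (apply T (i , false)) ≟ᶠ proj₁ (apply T (i , true)))) (allFin n)

fixedPointFree : ∀ {n} → Table n → Bool
fixedPointFree {n} T = all (λ x → not (does (apply T x ≟F x))) (allFacets n)

isCDerangement : ∀ {n} → Table n → Bool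
isCDerangement T = isPerm T ∧ preservesPairs T ∧ fixedPointFree T

-- number of c-derangements of Q_n (gives d̂ 0 = 1, d̂ 1 = 1)
d̂ : ℕ → ℕ
d̂ n = length (filter (λ T → isCDerangement T Data.Bool.≟ true) (allTables n))

-- A c-derangement of Q_n is determined by where it sends the facets i = (i , false): a signed
-- map σ i = (π i , εᵢ) with π a permutation of the axes, facet i* going to the facet opposite
-- σ i.  It fixes a facet exactly when π i = i and εᵢ = false for some i.
-- Classify such signed derangements s of m + 1 axes by the new axis 0.
--  (A) s 0 = 0*: deleting axis 0 leaves a signed derangement of m axes.
--  Otherwise 0 lies on a cycle p+1 ↦ 0^a ↦ (q+1)^b.  Short-circuiting it to p ↦ q^(a xor b)
--  gives a signed map ρ of m axes that can fix a facet only at p, and s is recovered from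
--  (p , a , ρ).  Either (B) ρ is a signed derangement, or (C) ρ p = (p , false) and deleting
--  axis p leaves a signed derangement of m - 1 axes.
-- So d̂ (m + 1) = d̂ m + 2m (d̂ m + d̂ (m - 1)); on the enumerated tables this is a bijection
-- between the c-derangements and a duplicate-free list of parameters for (A), (B), (C).

module Submission where

open import Defs
open import Data.Bool using (Bool; true; false; not; _∧_; _∨_; _xor_; T)
open import Data.Bool.Properties using (T-≡; _≟_; T-∧; ¬-not; xor-assoc; xor-comm; xor-same)
open import Data.Bool.ListAction using (all; any)
open import Data.Fin using (Fin; zero; suc; punchIn; punchOut)
open import Data.Fin.Properties
  using (any?; injective⇒≤; 0≢1+n; suc-injective; punchInᵢ≢i; punchIn-injective; punchOut-injective;
         punchOut-cong; punchIn-punchOut; punchOut-punchIn)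
  renaming (_≟_ to _≟ᶠ_)
open import Data.List
  using (List; []; _∷_; _++_; map; filter; length; concatMap; cartesianProduct; cartesianProductWith; allFin)
open import Data.List.Properties using (length-map; length-++; length-tabulate)
open import Data.List.Membership.Propositional using (_∈_; lose)
open import Data.List.Membership.Propositional.Properties
  using (∈-map⁺; ∈-map⁻; ∈-++⁺ˡ; ∈-++⁺ʳ; ∈-++⁻; ∈-filter⁺; ∈-filter⁻; ∈-allFin;
         ∈-cartesianProduct⁺; ∈-cartesianProduct⁻; ∈-cartesianProductWith⁺)
open import Data.List.Membership.Propositional.Properties.WithK using (unique∧set⇒bag)
open import Data.List.Relation.Binary.BagAndSetEquality using (_∼[_]_; set; ∼bag⇒↭)
open import Data.List.Relation.Binary.Permutation.Propositional.Properties using (↭-length)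
import Data.List.Relation.Unary.All as All
import Data.List.Relation.Unary.All.Properties as All
open import Data.List.Relation.Unary.Any using (here; there)
open import Data.List.Relation.Unary.Any.Properties using (any⁺)
open import Data.List.Relation.Unary.Unique.Propositional using (Unique; []; _∷_)
import Data.List.Relation.Unary.Unique.Propositional.Properties as Unique
open import Data.Nat using (ℕ; zero; suc; _+_; _*_; _∸_; _≤_; z≤n; s≤s)
open import Data.Nat.Tactic.RingSolver using (solve-∀)
open import Data.Nat.Properties using (1+n≰n)
open import Data.Product using (∃-syntax; _×_; _,_; proj₁; proj₂)
open import Data.Sum using (_⊎_; inj₁; inj₂)
open import Data.Sum.Properties using (inj₁-injective; inj₂-injective)
open import Data.Vec using (Vec; []; _∷_; tabulate)
open import Data.Vec.Properties using (∷-injective; lookup∘tabulate; tabulate∘lookup; tabulate-cong)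
open import Function using (id; _∘_; mk⇔; Equivalence)
open import Relation.Nullary using (¬_; Dec; yes; no; does; contradiction)
open import Relation.Unary using (Decidable)
open import Relation.Binary.PropositionalEquality

private variable
  A B C : Set
  n : ℕ

Unique-map⁺ : (f : A → B) {xs : List A} →
  (∀ {x y} → x ∈ xs → y ∈ xs → f x ≡ f y → x ≡ y) → Unique xs → Unique (map f xs)
Unique-map⁺ f inj [] = []
Unique-map⁺ f inj (x∉ ∷ u) =
  All.map⁺ (All.tabulate λ y∈ fx≡fy → All.lookup x∉ y∈ (inj (here refl) (there y∈) fx≡fy))
  ∷ Unique-map⁺ f (λ x∈ y∈ → inj (there x∈) (there y∈)) u

length-filter-bijection : {P : A → Set} (P? : Decidable P) {xs : List A} {ys : List B} (f : B → A) →
  Unique xs → (∀ x → x ∈ xs) → Unique ys →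
  (∀ {y y'} → y ∈ ys → y' ∈ ys → f y ≡ f y' → y ≡ y') →
  (∀ {y} → y ∈ ys → P (f y)) →
  (∀ {x} → P x → ∃[ y ] y ∈ ys × f y ≡ x) →
  length (filter P? xs) ≡ length ys
length-filter-bijection P? {xs} {ys} f xs-unique xs-complete ys-unique f-injective f-sound f-onto =
  begin
    length (filter P? xs) ≡⟨ ↭-length (∼bag⇒↭ (unique∧set⇒bag
                                 (Unique.filter⁺ P? {xs} xs-unique) (Unique-map⁺ f f-injective ys-unique) same)) ⟩
    length (map f ys)      ≡⟨ length-map f ys ⟩
    length ys              ∎
  where
  open ≡-Reasoning
  same : filter P? xs ∼[ set ] map f ys
  same = mk⇔ to from
    where
    to : ∀ {x} → x ∈ filter P? xs → x ∈ map f ys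
    to x∈ with y , y∈ , refl ← f-onto (proj₂ (∈-filter⁻ P? {xs = xs} x∈)) = ∈-map⁺ f y∈
    from : ∀ {x} → x ∈ map f ys → x ∈ filter P? xs
    from x∈ with y , y∈ , refl ← ∈-map⁻ f x∈ = ∈-filter⁺ P? {xs = xs} (xs-complete _) (f-sound y∈)

length-cartesianProduct : (xs : List A) (ys : List B) →
  length (cartesianProduct xs ys) ≡ length xs * length ys
length-cartesianProduct []       ys = refl
length-cartesianProduct (x ∷ xs) ys = begin
  length (map (x ,_) ys ++ cartesianProduct xs ys)        ≡⟨ length-++ (map (x ,_) ys) ⟩
  length (map (x ,_) ys) + length (cartesianProduct xs ys)
    ≡⟨ cong₂ _+_ (length-map (x ,_) ys) (length-cartesianProduct xs ys) ⟩
  length ys + length xs * length ys                        ∎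
  where open ≡-Reasoning

infixr 5 _⊎ˡ_
_⊎ˡ_ : List A → List B → List (A ⊎ B)
xs ⊎ˡ ys = map inj₁ xs ++ map inj₂ ys

length-⊎ˡ : (xs : List A) (ys : List B) → length (xs ⊎ˡ ys) ≡ length xs + length ys
length-⊎ˡ xs ys = trans (length-++ (map inj₁ xs)) (cong₂ _+_ (length-map inj₁ xs) (length-map inj₂ ys))

module _ {xs : List A} {ys : List B} where

  Unique-⊎ˡ : Unique xs → Unique ys → Unique (xs ⊎ˡ ys)
  Unique-⊎ˡ xs-unique ys-unique =
    Unique.++⁺ (Unique.map⁺ inj₁-injective xs-unique) (Unique.map⁺ inj₂-injective ys-unique) disjoint
    where
    disjoint : ∀ {z} → ¬ (z ∈ map inj₁ xs × z ∈ map inj₂ ys)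
    disjoint (z∈₁ , z∈₂) with _ , _ , refl ← ∈-map⁻ inj₁ z∈₁ with _ , _ , () ← ∈-map⁻ inj₂ z∈₂

  ∈-⊎ˡ⁺ˡ : ∀ {x} → x ∈ xs → inj₁ x ∈ xs ⊎ˡ ys
  ∈-⊎ˡ⁺ˡ x∈ = ∈-++⁺ˡ (∈-map⁺ inj₁ x∈)

  ∈-⊎ˡ⁺ʳ : ∀ {y} → y ∈ ys → inj₂ y ∈ xs ⊎ˡ ys
  ∈-⊎ˡ⁺ʳ y∈ = ∈-++⁺ʳ (map inj₁ xs) (∈-map⁺ inj₂ y∈)

  ∈-⊎ˡ⁻ˡ : ∀ {x} → inj₁ x ∈ xs ⊎ˡ ys → x ∈ xs
  ∈-⊎ˡ⁻ˡ x∈ with ∈-++⁻ (map inj₁ xs) x∈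
  ... | inj₁ x∈₁ with _ , x∈ , refl ← ∈-map⁻ inj₁ x∈₁ = x∈
  ... | inj₂ x∈₂ with _ , _ , () ← ∈-map⁻ inj₂ x∈₂

  ∈-⊎ˡ⁻ʳ : ∀ {y} → inj₂ y ∈ xs ⊎ˡ ys → y ∈ ys
  ∈-⊎ˡ⁻ʳ y∈ with ∈-++⁻ (map inj₁ xs) y∈
  ... | inj₁ y∈₁ with _ , _ , () ← ∈-map⁻ inj₁ y∈₁
  ... | inj₂ y∈₂ with _ , y∈ , refl ← ∈-map⁻ inj₂ y∈₂ = y∈

module _ {xs : List A} (complete : ∀ x → x ∈ xs) (p : A → Bool) where

  all-everywhere : T (all p xs) → ∀ x → T (p x)
  all-everywhere h x = All.lookup (All.all⁺ p xs h) (complete x)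

  everywhere-all : (∀ x → T (p x)) → T (all p xs)
  everywhere-all h = All.all⁻ p {xs = xs} (All.tabulate λ {x} _ → h x)

  somewhere-any : ∀ x → T (p x) → T (any p xs)
  somewhere-any x px = any⁺ p (lose (complete x) px)

module _ {P : Set} where

  does-true : (d : Dec P) → P → T (does d)
  does-true (yes _) _ = _
  does-true (no ¬p) p = ¬p p

  does-true⁻ : (d : Dec P) → T (does d) → P
  does-true⁻ (yes p) _ = p

  does-false : (d : Dec P) → ¬ P → T (not (does d))
  does-false (yes p) ¬p = ¬p p
  does-false (no _)  _  = _

  does-false⁻ : (d : Dec P) → T (not (does d)) → ¬ P
  does-false⁻ (no ¬p) _ = ¬p

xor-involutiveˡ : ∀ a b → a xor (a xor b) ≡ b
xor-involutiveˡ a b = trans (sym (xor-assoc a a b)) (cong (_xor b) (xor-same a))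

xor-involutiveʳ : ∀ a b → (a xor b) xor b ≡ a
xor-involutiveʳ a b = trans (xor-comm (a xor b) b) (trans (cong (b xor_) (xor-comm a b)) (xor-involutiveˡ b a))

xor-cancelˡ : ∀ a {b c} → a xor b ≡ a xor c → b ≡ c
xor-cancelˡ a {b} {c} e = trans (sym (xor-involutiveˡ a b)) (trans (cong (a xor_) e) (xor-involutiveˡ a c))

xor-cancelʳ : ∀ {a b} c → a xor c ≡ b xor c → a ≡ b
xor-cancelʳ {a} {b} c e = trans (sym (xor-involutiveʳ a c)) (trans (cong (_xor c) e) (xor-involutiveʳ b c))

injective⇒surjective : {f : Fin n → Fin n} → (∀ {x y} → f x ≡ f y → x ≡ y) → ∀ y → ∃[ x ] f x ≡ y
injective⇒surjective {zero} _ ()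
injective⇒surjective {suc n} {f} f-injective y with any? (λ x → f x ≟ᶠ y)
... | yes found = found
... | no missed = contradiction (injective⇒≤ f′-injective) 1+n≰n
  where
  y≢f : ∀ x → y ≢ f x
  y≢f x y≡fx = missed (x , sym y≡fx)
  f′ : Fin (suc n) → Fin n
  f′ x = punchOut (y≢f x)
  f′-injective : ∀ {x x′} → f′ x ≡ f′ x′ → x ≡ x′
  f′-injective = f-injective ∘ punchOut-injective (y≢f _) (y≢f _)

data PunchInView {n} (i : Fin (suc n)) : Fin (suc n) → Set where
  at  : PunchInView i i
  off : ∀ k → PunchInView i (punchIn i k)

punchInView : (i j : Fin (suc n)) → PunchInView i j
punchInView i j with i ≟ᶠ j
... | yes refl = at
... | no i≢j   = subst (PunchInView i) (punchIn-punchOut i≢j) (off (punchOut i≢j))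

concatMap-map≡cartesianProductWith : (f : A → B → C) (xs : List A) (ys : List B) →
  concatMap (λ x → map (f x) ys) xs ≡ cartesianProductWith f xs ys
concatMap-map≡cartesianProductWith f []       ys = refl
concatMap-map≡cartesianProductWith f (x ∷ xs) ys =
  cong (map (f x) ys ++_) (concatMap-map≡cartesianProductWith f xs ys)

allVecs-suc : (xs : List A) (m : ℕ) → allVecs xs (suc m) ≡ cartesianProductWith _∷_ xs (allVecs xs m)
allVecs-suc xs m = concatMap-map≡cartesianProductWith _∷_ xs (allVecs xs m)

∈-allVecs : {xs : List A} → (∀ x → x ∈ xs) → (v : Vec A n) → v ∈ allVecs xs n
∈-allVecs complete []      = here refl
∈-allVecs {xs = xs} complete (_∷_ {n} x v) =
  subst (_ ∈_) (sym (allVecs-suc xs n)) (∈-cartesianProductWith⁺ _∷_ (complete x) (∈-allVecs complete v))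

Unique-allVecs : {xs : List A} → Unique xs → Unique (allVecs xs n)
Unique-allVecs {n = zero}            u = All.[] ∷ []
Unique-allVecs {n = suc n} {xs = xs} u =
  subst Unique (sym (allVecs-suc xs n)) (Unique.cartesianProductWith⁺ _∷_ ∷-injective u (Unique-allVecs u))

allBools : List Bool
allBools = true ∷ false ∷ []

∈-allBools : ∀ b → b ∈ allBools
∈-allBools true  = here refl
∈-allBools false = there (here refl)

Unique-allBools : Unique allBools
Unique-allBools = ((λ ()) All.∷ All.[]) ∷ All.[] ∷ []

∈-allFacets : (x : Facet n) → x ∈ allFacets n
∈-allFacets (i , b) = ∈-cartesianProduct⁺ (∈-allFin i) (∈-allBools b)

Unique-allFacets : Unique (allFacets n)
Unique-allFacets {n} = Unique.cartesianProduct⁺ (Unique.allFin⁺ n) Unique-allBools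

∈-allTables : (t : Table n) → t ∈ allTables n
∈-allTables = ∈-allVecs λ (x , y) → ∈-cartesianProduct⁺ (∈-allFacets x) (∈-allFacets y)

Unique-allTables : Unique (allTables n)
Unique-allTables = Unique-allVecs (Unique.cartesianProduct⁺ Unique-allFacets Unique-allFacets)

SignedMap : ℕ → Set
SignedMap n = Fin n → Facet n

axis : SignedMap n → Fin n → Fin n
axis σ i = proj₁ (σ i)

sign : SignedMap n → Fin n → Bool
sign σ i = proj₂ (σ i)

facetMap : SignedMap n → Facet n → Facet n
facetMap σ (i , b) = axis σ i , b xor sign σ i

toTable : SignedMap n → Table n
toTable σ = tabulate λ i → facetMap σ (i , false) , facetMap σ (i , true)

signedMap : Table n → SignedMap n
signedMap t i = apply t (i , false)

AxisInjective : SignedMap n → Set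
AxisInjective σ = ∀ {i j} → axis σ i ≡ axis σ j → i ≡ j

Fixes : SignedMap n → Fin n → Set
Fixes σ i = σ i ≡ (i , false)

FixesNothing : SignedMap n → Set
FixesNothing σ = ∀ i → ¬ Fixes σ i

IsSignedDerangement : SignedMap n → Set
IsSignedDerangement σ = AxisInjective σ × FixesNothing σ

IsCDerangement : Table n → Set
IsCDerangement t = isCDerangement t ≡ true

apply-toTable : (σ : SignedMap n) (x : Facet n) → apply (toTable σ) x ≡ facetMap σ x
apply-toTable σ (i , false) = cong proj₁ (lookup∘tabulate _ i)
apply-toTable σ (i , true)  = cong proj₂ (lookup∘tabulate _ i)

signedMap-toTable : (σ : SignedMap n) → signedMap (toTable σ) ≗ σ
signedMap-toTable σ i = apply-toTable σ (i , false)

toTable-cong : {σ σ′ : SignedMap n} → σ ≗ σ′ → toTable σ ≡ toTable σ′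
toTable-cong σ≗σ′ = tabulate-cong λ i → cong (λ (j , s) → (j , s) , (j , not s)) (σ≗σ′ i)

toTable-injective : {σ σ′ : SignedMap n} → toTable σ ≡ toTable σ′ → σ ≗ σ′
toTable-injective {σ = σ} {σ′} eq i =
  trans (sym (signedMap-toTable σ i)) (trans (cong (λ t → signedMap t i) eq) (signedMap-toTable σ′ i))

module _ {σ : SignedMap n} (σ-injective : AxisInjective σ) where

  facetMap-injective : ∀ {x y} → facetMap σ x ≡ facetMap σ y → x ≡ y
  facetMap-injective {i , b} {j , c} eq with refl ← σ-injective (cong proj₁ eq) =
    cong (i ,_) (xor-cancelʳ (sign σ i) (cong proj₂ eq))

  facetMap-surjective : ∀ y → ∃[ x ] facetMap σ x ≡ y
  facetMap-surjective (j , c) with i , refl ← injective⇒surjective σ-injective j =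
    (i , c xor sign σ i) , cong (j ,_) (xor-involutiveʳ c (sign σ i))

  isPerm-toTable : T (isPerm (toTable σ))
  isPerm-toTable = Equivalence.from T-∧ (injective , surjective)
    where
    t : Table n
    t = toTable σ
    injectiveAt : ∀ x y → T (not (does (apply t x ≟F apply t y)) ∨ does (x ≟F y))
    injectiveAt x y with apply t x ≟F apply t y
    ... | no _   = _
    ... | yes eq = does-true (x ≟F y)
                     (facetMap-injective (trans (sym (apply-toTable σ x)) (trans eq (apply-toTable σ y))))
    injective : T (all (λ x → all (λ y → not (does (apply t x ≟F apply t y)) ∨ does (x ≟F y)) (allFacets n))
                       (allFacets n))
    injective = everywhere-all ∈-allFacets _ λ x → everywhere-all ∈-allFacets _ (injectiveAt x)
    surjective : T (all (λ y → any (λ x → does (apply t x ≟F y)) (allFacets n)) (allFacets n))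
    surjective = everywhere-all ∈-allFacets _ λ y →
      let x , eq = facetMap-surjective y
      in somewhere-any ∈-allFacets _ x (does-true (_ ≟F _) (trans (apply-toTable σ x) eq))

facetMap-fixes : {σ : SignedMap n} {i : Fin n} {b : Bool} → facetMap σ (i , b) ≡ (i , b) → Fixes σ i
facetMap-fixes {σ = σ} {i} {b} eq = cong₂ _,_ (cong proj₁ eq)
  (trans (sym (xor-involutiveˡ b (sign σ i))) (trans (cong (b xor_) (cong proj₂ eq)) (xor-same b)))

preservesPairs-toTable : (σ : SignedMap n) → T (preservesPairs (toTable σ))
preservesPairs-toTable σ = everywhere-all ∈-allFin _ λ i →
  does-true (_ ≟ᶠ _)
    (trans (cong proj₁ (apply-toTable σ (i , false))) (sym (cong proj₁ (apply-toTable σ (i , true)))))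

fixedPointFree-toTable : {σ : SignedMap n} → FixesNothing σ → T (fixedPointFree (toTable σ))
fixedPointFree-toTable {σ = σ} σ-fixesNothing = everywhere-all ∈-allFacets _ λ x →
  does-false (_ ≟F _) λ eq → σ-fixesNothing _ (facetMap-fixes {σ = σ} (trans (sym (apply-toTable σ x)) eq))

toTable-isCDerangement : {σ : SignedMap n} → IsSignedDerangement σ → IsCDerangement (toTable σ)
toTable-isCDerangement {σ = σ} (σ-injective , σ-fixesNothing) = Equivalence.to T-≡
  (Equivalence.from T-∧ (isPerm-toTable σ-injective ,
   Equivalence.from T-∧ (preservesPairs-toTable σ , fixedPointFree-toTable σ-fixesNothing)))

module _ (t : Table n) (t-isCDerangement : IsCDerangement t) where

  private
    σ : SignedMap n
    σ = signedMap t
    cd : T (isPerm t ∧ preservesPairs t ∧ fixedPointFree t)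
    cd = Equivalence.from T-≡ t-isCDerangement
    isPerm-t : T (isPerm t)
    isPerm-t = proj₁ (Equivalence.to (T-∧ {isPerm t}) cd)
    pairs∧free-t : T (preservesPairs t ∧ fixedPointFree t)
    pairs∧free-t = proj₂ (Equivalence.to (T-∧ {isPerm t}) cd)
    preservesPairs-t : T (preservesPairs t)
    preservesPairs-t = proj₁ (Equivalence.to (T-∧ {preservesPairs t}) pairs∧free-t)
    fixedPointFree-t : T (fixedPointFree t)
    fixedPointFree-t = proj₂ (Equivalence.to (T-∧ {preservesPairs t}) pairs∧free-t)

  apply-injective : ∀ {x y} → apply t x ≡ apply t y → x ≡ y
  apply-injective {x} {y} eq with apply t x ≟F apply t y | x ≟F y
    | all-everywhere ∈-allFacets _ (all-everywhere ∈-allFacets _ (proj₁ (Equivalence.to T-∧ isPerm-t)) x) y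
  ... | _      | yes x≡y | _ = x≡y
  ... | no neq | no _    | _ = contradiction eq neq

  apply-sameAxis : ∀ i → proj₁ (apply t (i , false)) ≡ proj₁ (apply t (i , true))
  apply-sameAxis i = does-true⁻ (_ ≟ᶠ _) (all-everywhere ∈-allFin _ preservesPairs-t i)

  apply-fixesNothing : ∀ x → apply t x ≢ x
  apply-fixesNothing x = does-false⁻ (_ ≟F _) (all-everywhere ∈-allFacets _ fixedPointFree-t x)

  apply-facetMap : ∀ x → apply t x ≡ facetMap σ x
  apply-facetMap (i , false) = refl
  apply-facetMap (i , true)  = cong₂ _,_ (sym (apply-sameAxis i)) (¬-not λ eq →
    contradiction (apply-injective {x = i , true} {y = i , false} (cong₂ _,_ (sym (apply-sameAxis i)) eq)) λ ())

  toTable-signedMap : toTable σ ≡ t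
  toTable-signedMap = trans
    (tabulate-cong λ i → cong₂ _,_ (sym (apply-facetMap (i , false))) (sym (apply-facetMap (i , true))))
    (tabulate∘lookup t)

  signedMap-isSignedDerangement : IsSignedDerangement σ
  signedMap-isSignedDerangement = σ-injective , λ i → apply-fixesNothing (i , false)
    where
    σ-injective : AxisInjective σ
    σ-injective {i} {j} eq = cong proj₁ (apply-injective {x = i , false} {y = j , b}
      (trans (cong₂ _,_ eq (sym (xor-involutiveʳ (sign σ i) (sign σ j)))) (sym (apply-facetMap (j , b)))))
      where
      b : Bool
      b = sign σ i xor sign σ j

isCDerangement-ext : {t t′ : Table n} → IsCDerangement t → IsCDerangement t′ →
  signedMap t ≗ signedMap t′ → t ≡ t′
isCDerangement-ext {t = t} {t′} t-cd t′-cd eq =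
  trans (sym (toTable-signedMap t t-cd)) (trans (toTable-cong eq) (toTable-signedMap t′ t′-cd))

isCDerangement? : Decidable (IsCDerangement {n})
isCDerangement? t = isCDerangement t ≟ true

cDerangements : (n : ℕ) → List (Table n)
cDerangements n = filter isCDerangement? (allTables n)

∈-cDerangements⁺ : {t : Table n} → IsCDerangement t → t ∈ cDerangements n
∈-cDerangements⁺ {n} {t} = ∈-filter⁺ isCDerangement? {xs = allTables n} (∈-allTables t)

Unique-cDerangements : Unique (cDerangements n)
Unique-cDerangements = Unique.filter⁺ isCDerangement? Unique-allTables

∈-cDerangements⁻ : {t : Table n} → t ∈ cDerangements n → IsCDerangement t
∈-cDerangements⁻ {n} t∈ = proj₂ (∈-filter⁻ isCDerangement? {xs = allTables n} t∈)

FixesNothingBut : Fin n → SignedMap n → Set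
FixesNothingBut p σ = ∀ j → j ≢ p → ¬ Fixes σ j

IsSignedDerangementBut : Fin n → SignedMap n → Set
IsSignedDerangementBut p σ = AxisInjective σ × FixesNothingBut p σ

insertAxis : Fin (suc n) → Bool → SignedMap n → SignedMap (suc n)
insertAxis i b τ j with i ≟ᶠ j
... | yes _  = i , b
... | no i≢j = punchIn i (axis τ (punchOut i≢j)) , sign τ (punchOut i≢j)

module _ (i : Fin (suc n)) (b : Bool) where

  insertAxis-at : (τ : SignedMap n) → insertAxis i b τ i ≡ (i , b)
  insertAxis-at τ with i ≟ᶠ i
  ... | yes _  = refl
  ... | no i≢i = contradiction refl i≢i

  insertAxis-punchIn : (τ : SignedMap n) (k : Fin n) →
    insertAxis i b τ (punchIn i k) ≡ (punchIn i (axis τ k) , sign τ k)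
  insertAxis-punchIn τ k with i ≟ᶠ punchIn i k
  ... | yes i≡ = contradiction (sym i≡) (punchInᵢ≢i i k)
  ... | no _   = cong (λ k′ → punchIn i (axis τ k′) , sign τ k′)
                      (trans (punchOut-cong i refl) (punchOut-punchIn i))

  insertAxis-cong : {τ τ′ : SignedMap n} → τ ≗ τ′ → insertAxis i b τ ≗ insertAxis i b τ′
  insertAxis-cong τ≗τ′ j with i ≟ᶠ j
  ... | yes _  = refl
  ... | no i≢j = cong (λ (k , s) → punchIn i k , s) (τ≗τ′ (punchOut i≢j))

  insertAxis-cancel : {τ τ′ : SignedMap n} → insertAxis i b τ ≗ insertAxis i b τ′ → τ ≗ τ′
  insertAxis-cancel {τ} {τ′} eq k = cong₂ _,_ (punchIn-injective i _ _ (cong proj₁ eq′)) (cong proj₂ eq′)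
    where
    eq′ : (punchIn i (axis τ k) , sign τ k) ≡ (punchIn i (axis τ′ k) , sign τ′ k)
    eq′ = trans (sym (insertAxis-punchIn τ k)) (trans (eq (punchIn i k)) (insertAxis-punchIn τ′ k))

  private
    axisAt : ∀ τ → axis (insertAxis i b τ) i ≡ i
    axisAt τ = cong proj₁ (insertAxis-at τ)
    axisOff : ∀ τ k → axis (insertAxis i b τ) (punchIn i k) ≡ punchIn i (axis τ k)
    axisOff τ k = cong proj₁ (insertAxis-punchIn τ k)

  insertAxis-injective : {τ : SignedMap n} → AxisInjective τ → AxisInjective (insertAxis i b τ)
  insertAxis-injective {τ} τ-injective {x} {y} eq with punchInView i x | punchInView i y
  ... | at    | at     = refl
  ... | at    | off k  = contradiction (trans (sym (axisAt τ)) (trans eq (axisOff τ k))) (punchInᵢ≢i i _ ∘ sym)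
  ... | off k | at     = contradiction (trans (sym (axisAt τ)) (trans (sym eq) (axisOff τ k))) (punchInᵢ≢i i _ ∘ sym)
  ... | off k | off k′ = cong (punchIn i) (τ-injective (punchIn-injective i _ _
                           (trans (sym (axisOff τ k)) (trans eq (axisOff τ k′)))))

  insertAxis-isSignedDerangementBut : {τ : SignedMap n} → IsSignedDerangement τ →
    IsSignedDerangementBut i (insertAxis i b τ)
  insertAxis-isSignedDerangementBut {τ} (τ-injective , τ-fixesNothing) =
    insertAxis-injective τ-injective , fixesNothingBut
    where
    fixesNothingBut : FixesNothingBut i (insertAxis i b τ)
    fixesNothingBut j j≢i fixes with punchInView i j
    ... | at    = j≢i refl
    ... | off k = τ-fixesNothing k (cong₂ _,_ (punchIn-injective i _ _ (cong proj₁ fixes′)) (cong proj₂ fixes′))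
      where
      fixes′ : (punchIn i (axis τ k) , sign τ k) ≡ (punchIn i k , false)
      fixes′ = trans (sym (insertAxis-punchIn τ k)) fixes

insertAxis-reflected : (i : Fin (suc n)) {τ : SignedMap n} →
  IsSignedDerangement τ → IsSignedDerangement (insertAxis i true τ)
insertAxis-reflected i {τ} τ-sd with insertAxis-isSignedDerangementBut i true τ-sd
... | injective , fixesNothingBut = injective , fixesNothing
  where
  fixesNothing : FixesNothing (insertAxis i true τ)
  fixesNothing j with j ≟ᶠ i
  ... | yes refl = λ fixes → contradiction (trans (sym (insertAxis-at i true τ)) fixes) λ ()
  ... | no j≢i   = fixesNothingBut j j≢i

module AxisRemoval {ρ : SignedMap (suc n)} (ρ-injective : AxisInjective ρ)
                   {i : Fin (suc n)} {b : Bool} (ρ-at-i : ρ i ≡ (i , b)) where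

  private
    i≢axis : ∀ k → i ≢ axis ρ (punchIn i k)
    i≢axis k i≡ = punchInᵢ≢i i k (sym (ρ-injective (trans (cong proj₁ ρ-at-i) i≡)))

  removeAxis : SignedMap n
  removeAxis k = punchOut (i≢axis k) , sign ρ (punchIn i k)

  insertAxis-removeAxis : insertAxis i b removeAxis ≗ ρ
  insertAxis-removeAxis j with punchInView i j
  ... | at    = trans (insertAxis-at i b removeAxis) (sym ρ-at-i)
  ... | off k = trans (insertAxis-punchIn i b removeAxis k)
                      (cong (_, sign ρ (punchIn i k)) (punchIn-punchOut (i≢axis k)))

  removeAxis-injective : AxisInjective removeAxis
  removeAxis-injective eq = punchIn-injective i _ _ (ρ-injective (punchOut-injective (i≢axis _) (i≢axis _) eq))

  removeAxis-fixes : ∀ {k} → Fixes removeAxis k → Fixes ρ (punchIn i k)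
  removeAxis-fixes {k} fixes =
    cong₂ _,_ (trans (sym (punchIn-punchOut (i≢axis k))) (cong (punchIn i) (cong proj₁ fixes))) (cong proj₂ fixes)

-- Reroutes p ↦ ρ p through the new axis 0 as p+1 ↦ 0^a ↦ (ρ p + 1)^(a xor sign ρ p): the two
-- signs compose to the sign of ρ p.
splice : Fin n → Bool → SignedMap n → SignedMap (suc n)
splice p a ρ zero    = suc (axis ρ p) , a xor sign ρ p
splice p a ρ (suc j) with j ≟ᶠ p
... | yes _ = zero , a
... | no _  = suc (axis ρ j) , sign ρ j

module _ {p : Fin n} {a : Bool} where

  splice-cong : {ρ ρ′ : SignedMap n} → ρ ≗ ρ′ → splice p a ρ ≗ splice p a ρ′
  splice-cong ρ≗ρ′ zero = cong (λ (k , s) → suc k , a xor s) (ρ≗ρ′ p)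
  splice-cong ρ≗ρ′ (suc j) with j ≟ᶠ p
  ... | yes _ = refl
  ... | no _  = cong (λ (k , s) → suc k , s) (ρ≗ρ′ j)

  splice-isSignedDerangement : {ρ : SignedMap n} → IsSignedDerangementBut p ρ → IsSignedDerangement (splice p a ρ)
  splice-isSignedDerangement {ρ} (ρ-injective , ρ-fixesNothingBut) = injective , fixesNothing
    where
    injective : AxisInjective (splice p a ρ)
    injective {zero}  {zero}  eq = refl
    injective {zero}  {suc j} eq with j ≟ᶠ p
    ... | yes refl = contradiction eq λ ()
    ... | no j≢p   = contradiction (ρ-injective (suc-injective eq)) (j≢p ∘ sym)
    injective {suc i} {zero}  eq = sym (injective {zero} {suc i} (sym eq))
    injective {suc i} {suc j} eq with i ≟ᶠ p | j ≟ᶠ p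
    ... | yes refl | yes refl = refl
    ... | yes refl | no _     = contradiction eq λ ()
    ... | no _     | yes refl = contradiction eq λ ()
    ... | no _     | no _     = cong suc (ρ-injective (suc-injective eq))
    fixesNothing : FixesNothing (splice p a ρ)
    fixesNothing zero    ()
    fixesNothing (suc j) fixes with j ≟ᶠ p
    ... | yes refl = contradiction fixes λ ()
    ... | no j≢p   = ρ-fixesNothingBut j j≢p (cong₂ _,_ (suc-injective (cong proj₁ fixes)) (cong proj₂ fixes))

splice-at : (p : Fin n) (a : Bool) (ρ : SignedMap n) → splice p a ρ (suc p) ≡ (zero , a)
splice-at p a ρ with p ≟ᶠ p
... | yes _  = refl
... | no p≢p = contradiction refl p≢p

splice-off : {p j : Fin n} (a : Bool) (ρ : SignedMap n) → j ≢ p →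
  splice p a ρ (suc j) ≡ (suc (axis ρ j) , sign ρ j)
splice-off {p = p} {j} a ρ j≢p with j ≟ᶠ p
... | yes j≡p = contradiction j≡p j≢p
... | no _    = refl

splice-cancel : {p p′ : Fin n} {a a′ : Bool} {ρ ρ′ : SignedMap n} →
  splice p a ρ ≗ splice p′ a′ ρ′ → p ≡ p′ × a ≡ a′ × ρ ≗ ρ′
splice-cancel {p = p} {p′} {a} {a′} {ρ} {ρ′} eq with p ≟ᶠ p′
... | no p≢p′ = contradiction (trans (sym (splice-at p a ρ)) (trans (eq (suc p)) (splice-off a′ ρ′ p≢p′))) λ ()
... | yes refl with refl ← cong proj₂ (trans (sym (splice-at p a ρ)) (trans (eq (suc p)) (splice-at p a′ ρ′))) =
  refl , refl , ρ≗ρ′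
  where
  ρ≗ρ′ : ρ ≗ ρ′
  ρ≗ρ′ j with j ≟ᶠ p
  ... | yes refl = cong₂ _,_ (suc-injective (cong proj₁ (eq zero))) (xor-cancelˡ a (cong proj₂ (eq zero)))
  ... | no j≢p   = cong₂ _,_ (suc-injective (cong proj₁ eq′)) (cong proj₂ eq′)
    where
    eq′ : (suc (axis ρ j) , sign ρ j) ≡ (suc (axis ρ′ j) , sign ρ′ j)
    eq′ = trans (sym (splice-off a ρ j≢p)) (trans (eq (suc j)) (splice-off a ρ′ j≢p))

module Unsplicing {s : SignedMap (suc n)} (s-injective : AxisInjective s)
                  {p q : Fin n} (s-entry : axis s (suc p) ≡ zero) (s-new : axis s zero ≡ suc q) where

  private
    zero≢axis : ∀ {j} → j ≢ p → zero ≢ axis s (suc j)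
    zero≢axis j≢p zero≡ = j≢p (suc-injective (s-injective (trans (sym zero≡) (sym s-entry))))

    q≢punchOut : ∀ {j} (j≢p : j ≢ p) → q ≢ punchOut (zero≢axis j≢p)
    q≢punchOut j≢p q≡ = 0≢1+n (s-injective (trans s-new (trans (cong suc q≡) (punchIn-punchOut (zero≢axis j≢p)))))

  unsplice : SignedMap n
  unsplice j with j ≟ᶠ p
  ... | yes _  = q , sign s (suc p) xor sign s zero
  ... | no j≢p = punchOut (zero≢axis j≢p) , sign s (suc j)

  private
    unsplice-at : unsplice p ≡ (q , sign s (suc p) xor sign s zero)
    unsplice-at with p ≟ᶠ p
    ... | yes _  = refl
    ... | no p≢p = contradiction refl p≢p

    unsplice-off : ∀ {j} → j ≢ p → (suc (axis unsplice j) , sign unsplice j) ≡ s (suc j)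
    unsplice-off {j} j≢p with j ≟ᶠ p
    ... | yes j≡p = contradiction j≡p j≢p
    ... | no j≢p′ = cong (_, sign s (suc j)) (punchIn-punchOut (zero≢axis j≢p′))

  splice-unsplice : splice p (sign s (suc p)) unsplice ≗ s
  splice-unsplice zero = trans (cong (λ (k , x) → suc k , sign s (suc p) xor x) unsplice-at)
                               (cong₂ _,_ (sym s-new) (xor-involutiveˡ (sign s (suc p)) (sign s zero)))
  splice-unsplice (suc j) with j ≟ᶠ p
  ... | yes refl = cong (_, sign s (suc p)) (sym s-entry)
  ... | no j≢p   = unsplice-off j≢p

  unsplice-injective : AxisInjective unsplice
  unsplice-injective {i} {j} eq with i ≟ᶠ p | j ≟ᶠ p
  ... | yes refl | yes refl = refl
  ... | yes refl | no j≢p   = contradiction eq (q≢punchOut j≢p)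
  ... | no i≢p   | yes refl = contradiction (sym eq) (q≢punchOut i≢p)
  ... | no i≢p   | no j≢p   = suc-injective (s-injective (punchOut-injective (zero≢axis i≢p) (zero≢axis j≢p) eq))

  unsplice-fixesNothingBut : FixesNothing s → FixesNothingBut p unsplice
  unsplice-fixesNothingBut s-fixesNothing j j≢p fixes with j ≟ᶠ p
  ... | yes j≡p = j≢p j≡p
  ... | no j≢p′ = s-fixesNothing (suc j)
    (cong₂ _,_ (trans (sym (punchIn-punchOut (zero≢axis j≢p′))) (cong suc (cong proj₁ fixes))) (cong proj₂ fixes))

reflected-or-spliced : {s : SignedMap (suc n)} → IsSignedDerangement s →
    (∃[ τ ] IsSignedDerangement τ × insertAxis zero true τ ≗ s)
  ⊎ (∃[ p ] ∃[ a ] ∃[ ρ ] IsSignedDerangementBut p ρ × splice p a ρ ≗ s)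
reflected-or-spliced {s = s} (s-injective , s-fixesNothing) with s zero in s-new
... | zero , false = contradiction s-new (s-fixesNothing zero)
... | zero , true  =
  inj₁ (removeAxis , (removeAxis-injective , λ k → s-fixesNothing (suc k) ∘ removeAxis-fixes) , insertAxis-removeAxis)
  where open AxisRemoval {ρ = s} s-injective s-new
... | suc q , _ with injective⇒surjective s-injective zero
...   | zero , s-zero  = contradiction (trans (sym s-zero) (cong proj₁ s-new)) 0≢1+n
...   | suc p , s-entry =
  inj₂ (p , sign s (suc p) , unsplice , (unsplice-injective , unsplice-fixesNothingBut s-fixesNothing) , splice-unsplice)
  where open Unsplicing {s = s} s-injective s-entry (cong proj₁ s-new)

derangement-or-fixedAxis : {p : Fin (suc n)} {ρ : SignedMap (suc n)} → IsSignedDerangementBut p ρ →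
  IsSignedDerangement ρ ⊎ ∃[ τ ] IsSignedDerangement τ × insertAxis p false τ ≗ ρ
derangement-or-fixedAxis {p = p} {ρ} (ρ-injective , ρ-fixesNothingBut) with ρ p ≟F (p , false)
... | no ¬fixes = inj₁ (ρ-injective , fixesNothing)
  where
  fixesNothing : FixesNothing ρ
  fixesNothing j with j ≟ᶠ p
  ... | yes refl = ¬fixes
  ... | no j≢p   = ρ-fixesNothingBut j j≢p
... | yes fixes =
  inj₂ (removeAxis , (removeAxis-injective , λ k → ρ-fixesNothingBut _ (punchInᵢ≢i p k) ∘ removeAxis-fixes) , insertAxis-removeAxis)
  where open AxisRemoval {ρ = ρ} ρ-injective fixes

module Recurrence (k : ℕ) where

  Choice : Set
  Choice = Table (suc k) ⊎ Table k

  IsValidChoice : Choice → Set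
  IsValidChoice (inj₁ t) = IsCDerangement t
  IsValidChoice (inj₂ t) = IsCDerangement t

  spliced : Fin (suc k) → Choice → SignedMap (suc k)
  spliced p (inj₁ t) = signedMap t
  spliced p (inj₂ t) = insertAxis p false (signedMap t)

  module _ (p : Fin (suc k)) where

    spliced-valid : {c : Choice} → IsValidChoice c → IsSignedDerangementBut p (spliced p c)
    spliced-valid {inj₁ t} t-cd = let ρ-injective , ρ-fixesNothing = signedMap-isSignedDerangement t t-cd
                                  in ρ-injective , λ j _ → ρ-fixesNothing j
    spliced-valid {inj₂ t} t-cd = insertAxis-isSignedDerangementBut p false (signedMap-isSignedDerangement t t-cd)

    spliced-injective : {c c′ : Choice} → IsValidChoice c → IsValidChoice c′ →
      spliced p c ≗ spliced p c′ → c ≡ c′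
    spliced-injective {inj₁ t} {inj₁ t′} t-cd t′-cd eq = cong inj₁ (isCDerangement-ext t-cd t′-cd eq)
    spliced-injective {inj₁ t} {inj₂ t′} t-cd t′-cd eq =
      contradiction (trans (eq p) (insertAxis-at p false _)) (proj₂ (signedMap-isSignedDerangement t t-cd) p)
    spliced-injective {inj₂ t} {inj₁ t′} t-cd t′-cd eq =
      contradiction (trans (sym (eq p)) (insertAxis-at p false _)) (proj₂ (signedMap-isSignedDerangement t′ t′-cd) p)
    spliced-injective {inj₂ t} {inj₂ t′} t-cd t′-cd eq =
      cong inj₂ (isCDerangement-ext t-cd t′-cd (insertAxis-cancel p false eq))

    spliced-surjective : {ρ : SignedMap (suc k)} → IsSignedDerangementBut p ρ →
      ∃[ c ] IsValidChoice c × spliced p c ≗ ρ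
    spliced-surjective {ρ} ρ-sd with derangement-or-fixedAxis {ρ = ρ} ρ-sd
    ... | inj₁ ρ-sd′ = inj₁ (toTable ρ) , toTable-isCDerangement ρ-sd′ , signedMap-toTable ρ
    ... | inj₂ (τ , τ-sd , eq) = inj₂ (toTable τ) , toTable-isCDerangement τ-sd ,
                                 λ j → trans (insertAxis-cong p false (signedMap-toTable τ) j) (eq j)

  -- inj₁ t is case (A), inj₂ (p , a , inj₁ t) case (B) and inj₂ (p , a , inj₂ t′) case (C).
  Parameter : Set
  Parameter = Table (suc k) ⊎ (Fin (suc k) × Bool × Choice)

  IsValid : Parameter → Set
  IsValid (inj₁ t)           = IsCDerangement t
  IsValid (inj₂ (_ , _ , c)) = IsValidChoice c

  encode : Parameter → SignedMap (suc (suc k))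
  encode (inj₁ t)           = insertAxis zero true (signedMap t)
  encode (inj₂ (p , a , c)) = splice p a (spliced p c)

  encode-valid : {y : Parameter} → IsValid y → IsSignedDerangement (encode y)
  encode-valid {inj₁ t}           t-cd    = insertAxis-reflected zero (signedMap-isSignedDerangement t t-cd)
  encode-valid {inj₂ (p , a , c)} c-valid = splice-isSignedDerangement (spliced-valid p c-valid)

  encode-injective : {y y′ : Parameter} → IsValid y → IsValid y′ → encode y ≗ encode y′ → y ≡ y′
  encode-injective {inj₁ t} {inj₁ t′} t-cd t′-cd eq =
    cong inj₁ (isCDerangement-ext t-cd t′-cd (insertAxis-cancel zero true eq))
  encode-injective {inj₁ t} {inj₂ _} _ _ eq =
    contradiction (trans (sym (insertAxis-at zero true (signedMap t))) (eq zero)) λ ()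
  encode-injective {inj₂ _} {inj₁ t} _ _ eq =
    contradiction (trans (sym (insertAxis-at zero true (signedMap t))) (sym (eq zero))) λ ()
  encode-injective {inj₂ (p , a , c)} {inj₂ _} c-valid c′-valid eq with refl , refl , eq′ ← splice-cancel eq =
    cong (λ c → inj₂ (p , a , c)) (spliced-injective p c-valid c′-valid eq′)

  encode-surjective : {s : SignedMap (suc (suc k))} → IsSignedDerangement s → ∃[ y ] IsValid y × encode y ≗ s
  encode-surjective s-sd with reflected-or-spliced s-sd
  ... | inj₁ (τ , τ-sd , eq) = inj₁ (toTable τ) , toTable-isCDerangement τ-sd ,
                               λ x → trans (insertAxis-cong zero true (signedMap-toTable τ) x) (eq x)
  ... | inj₂ (p , a , ρ , ρ-sd , eq) with c , c-valid , eq′ ← spliced-surjective p ρ-sd =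
    inj₂ (p , a , c) , c-valid , λ x → trans (splice-cong eq′ x) (eq x)

  choices : List Choice
  choices = cDerangements (suc k) ⊎ˡ cDerangements k

  parameters : List Parameter
  parameters = cDerangements (suc k) ⊎ˡ cartesianProduct (allFin (suc k)) (cartesianProduct allBools choices)

  ∈-parameters⁺ : {y : Parameter} → IsValid y → y ∈ parameters
  ∈-parameters⁺ {inj₁ t} t-cd = ∈-⊎ˡ⁺ˡ (∈-cDerangements⁺ t-cd)
  ∈-parameters⁺ {inj₂ (p , a , c)} c-valid =
    ∈-⊎ˡ⁺ʳ (∈-cartesianProduct⁺ (∈-allFin p) (∈-cartesianProduct⁺ (∈-allBools a) (∈-choices c c-valid)))
    where
    ∈-choices : ∀ c → IsValidChoice c → c ∈ choices
    ∈-choices (inj₁ t) t-cd = ∈-⊎ˡ⁺ˡ (∈-cDerangements⁺ t-cd)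
    ∈-choices (inj₂ t) t-cd = ∈-⊎ˡ⁺ʳ (∈-cDerangements⁺ t-cd)

  ∈-parameters⁻ : {y : Parameter} → y ∈ parameters → IsValid y
  ∈-parameters⁻ {inj₁ t} t∈ = ∈-cDerangements⁻ (∈-⊎ˡ⁻ˡ t∈)
  ∈-parameters⁻ {inj₂ (p , a , c)} y∈ =
    choices⁻ c (proj₂ (∈-cartesianProduct⁻ allBools choices
                (proj₂ (∈-cartesianProduct⁻ (allFin (suc k)) _ (∈-⊎ˡ⁻ʳ y∈)))))
    where
    choices⁻ : ∀ c → c ∈ choices → IsValidChoice c
    choices⁻ (inj₁ t) t∈ = ∈-cDerangements⁻ (∈-⊎ˡ⁻ˡ t∈)
    choices⁻ (inj₂ t) t∈ = ∈-cDerangements⁻ (∈-⊎ˡ⁻ʳ t∈)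

  Unique-parameters : Unique parameters
  Unique-parameters = Unique-⊎ˡ Unique-cDerangements (Unique.cartesianProduct⁺ (Unique.allFin⁺ (suc k))
    (Unique.cartesianProduct⁺ Unique-allBools (Unique-⊎ˡ Unique-cDerangements Unique-cDerangements)))

  d̂≡length-parameters : d̂ (suc (suc k)) ≡ length parameters
  d̂≡length-parameters = length-filter-bijection isCDerangement? (toTable ∘ encode)
    Unique-allTables ∈-allTables Unique-parameters
    (λ {y} {y′} y∈ y′∈ eq → encode-injective {y} {y′} (∈-parameters⁻ y∈) (∈-parameters⁻ y′∈)
                                (toTable-injective {σ = encode y} {encode y′} eq))
    (λ {y} y∈ → toTable-isCDerangement {σ = encode y} (encode-valid {y} (∈-parameters⁻ y∈)))
    λ {t} t-cd → let y , y-valid , eq = encode-surjective (signedMap-isSignedDerangement t t-cd)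
                 in y , ∈-parameters⁺ y-valid , trans (toTable-cong eq) (toTable-signedMap t t-cd)

  length-parameters : length parameters ≡ d̂ (suc k) + suc k * (2 * (d̂ (suc k) + d̂ k))
  length-parameters = begin
    length parameters ≡⟨ length-⊎ˡ (cDerangements (suc k)) _ ⟩
    d̂ (suc k) + length (cartesianProduct (allFin (suc k)) (cartesianProduct allBools choices))
      ≡⟨ cong (d̂ (suc k) +_) (length-cartesianProduct (allFin (suc k)) (cartesianProduct allBools choices)) ⟩
    d̂ (suc k) + length (allFin (suc k)) * length (cartesianProduct allBools choices)
      ≡⟨ cong₂ (λ x y → d̂ (suc k) + x * y)
               (length-tabulate {n = suc k} id) (length-cartesianProduct allBools choices) ⟩
    d̂ (suc k) + suc k * (2 * length choices)
      ≡⟨ cong (λ x → d̂ (suc k) + suc k * (2 * x)) (length-⊎ˡ (cDerangements (suc k)) (cDerangements k)) ⟩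
    d̂ (suc k) + suc k * (2 * (d̂ (suc k) + d̂ k)) ∎
    where open ≡-Reasoning

recurrence-arithmetic : ∀ k x y →
  x + suc k * (2 * (x + y)) ≡ (2 * suc (suc k) ∸ 1) * x + (2 * suc (suc k) ∸ 2) * y
recurrence-arithmetic = normalised
  where
  -- the right-hand side with both truncated subtractions evaluated, so that the ring solver applies
  normalised : ∀ k x y →
    x + suc k * (2 * (x + y)) ≡ (suc k + suc (suc k + 0)) * x + (k + suc (suc k + 0)) * y
  normalised = solve-∀

proposition3p3 : (n : ℕ) → 2 ≤ n →
    d̂ n ≡ (2 * n ∸ 1) * d̂ (n ∸ 1) + (2 * n ∸ 2) * d̂ (n ∸ 2)
proposition3p3 (suc (suc k)) (s≤s (s≤s z≤n)) = begin
  d̂ (suc (suc k))                              ≡⟨ d̂≡length-parameters ⟩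
  length parameters                            ≡⟨ length-parameters ⟩
  d̂ (suc k) + suc k * (2 * (d̂ (suc k) + d̂ k)) ≡⟨ recurrence-arithmetic k (d̂ (suc k)) (d̂ k) ⟩
  (2 * suc (suc k) ∸ 1) * d̂ (suc k) + (2 * suc (suc k) ∸ 2) * d̂ k ∎
  where
  open ≡-Reasoning
  open Recurrence k
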